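{- For every $n \geq 1$, every longest saturated chain from the minimum $0^n$ to the maximum $12^{n-1}$ of $(\mathsf{Tr}(n),\preccurlyeq)$ has length $2n-1$. Moreover, a triword $u \in \mathsf{Tr}(n)$ belongs to such a longest saturated chain if and only if for every index $i$ with $u_i = 0$ one has $u_j = 0$ for all $j \geq i$.
   Context: For $n\ge1$, $\mathsf{Tr}(n)$ is the set of words $u = u_1\cdots u_n$ over $\{0,1,2\}$ with $u_1 \neq 2$ and no indices $i<j$ with $u_i=0$, $u_j=1$, ordered componentwise ($u\preccurlyeq v$ iff $u_i\le v_i$ for all $i$). A saturated chain is a sequence $x_1 \lessdot x_2 \lessdot \cdots \lessdot x_r$ of covering relations; its length is $r-1$. -}

module Defs where

open import Data.Nat using (ℕ; zero; suc; _≤_)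
open import Data.Fin using (Fin; toℕ) renaming (_<_ to _<ᶠ_; _≤_ to _≤ᶠ_)
import Data.Fin as F
open import Data.Vec using (Vec; lookup; replicate; _∷_)
open import Data.Product using (_×_; Σ; ∃)
open import Data.Sum using (_⊎_)
open import Data.Empty using (⊥)
open import Relation.Nullary using (¬_)
open import Relation.Binary.PropositionalEquality using (_≡_; _≢_)

Letter : Set
Letter = Fin 3

𝟎 𝟏 𝟐 : Letter
𝟎 = F.zero
𝟏 = F.suc F.zero
𝟐 = F.suc (F.suc F.zero)

-- words of length n; position i : Fin n (0-based, so toℕ i ≡ 0 is u_1)
Word : ℕ → Set
Word n = Vec Letter n

IsTr : ∀ {n} → Word n → Set
IsTr {n} u =
  ((i : Fin n) → toℕ i ≡ 0 → lookup u i ≢ 𝟐) ×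
  ((i j : Fin n) → i <ᶠ j → lookup u i ≡ 𝟎 → lookup u j ≢ 𝟏)

_≼_ : ∀ {n} → Word n → Word n → Set
_≼_ {n} u v = (i : Fin n) → lookup u i ≤ᶠ lookup v i

_⋖_ : ∀ {n} → Word n → Word n → Set
_⋖_ {n} u v = IsTr u × IsTr v × u ≼ v × u ≢ v ×
  ((w : Word n) → IsTr w → u ≼ w → w ≼ v → (w ≡ u) ⊎ (w ≡ v))

-- saturated chains x_1 ⋖ x_2 ⋖ ... ⋖ x_r from a to b, indexed by length r-1
data SatChain {n} : Word n → Word n → ℕ → Set where
  single : ∀ {u} → IsTr u → SatChain u u 0
  step   : ∀ {u v w k} → u ⋖ v → SatChain v w k → SatChain u w (suc k)

_∈Ch_ : ∀ {n} {a b : Word n} {k} → Word n → SatChain a b k → Set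
_∈Ch_ {a = a} x (single _) = x ≡ a
_∈Ch_ {a = a} x (step _ c) = (x ≡ a) ⊎ (x ∈Ch c)

bot : (n : ℕ) → Word n
bot n = replicate n 𝟎

top : (m : ℕ) → Word (suc m)
top m = 𝟏 ∷ replicate m 𝟐

IsLongest : ∀ {n} {a b : Word n} {k} → SatChain a b k → Set
IsLongest {n} {a} {b} {k} _ = ∀ {k'} → SatChain a b k' → k' ≤ k

module Submission where

-- The weight of a word (the sum of its letters) is strictly monotone on ≼, so
-- every covering relation raises it by at least one; hence a saturated chain
-- from a to b has length at most weight b − weight a, which is 2n − 1 from
-- 0^n to 1 2^(n−1).  Conversely, a step that raises the weight by exactly one
-- is automatically a covering relation, and such steps can be taken greedily
-- (raise the first letter where a differs from b) as long as the target b is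
-- zero-suffixed, i.e. has no letter 0 before a letter 1 or 2: this yields a
-- chain of the maximal length weight b − weight a.  Chains attaining the bound
-- are "tight": every step raises the weight by one.  Along a tight chain, a
-- letter 2 standing after a letter 0 must already be present at the start,
-- which rules out such a pattern on any chain starting at 0^n.  The theorem
-- follows: the bound is attained, so longest chains have length 2n − 1; a
-- zero-suffixed triword lies on the concatenation of the greedy chains
-- 0^n → u → 1 2^(n−1); and a triword on a longest chain has no 0 before a 1
-- (being a triword) nor before a 2 (by the invariant), so it is zero-suffixed.

open import Defs
open import Data.Nat
  using (ℕ; zero; suc; _+_; _*_; _∸_; _≤_; _<_; z≤n; s≤s; _≟_)
open import Data.Nat.Properties
open import Data.Fin using (Fin; toℕ) renaming (_≤_ to _≤ᶠ_; _<_ to _<ᶠ_)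
import Data.Fin as F
import Data.Fin.Properties as FP
open import Data.Vec using ([]; _∷_; lookup; replicate; _[_]≔_)
open import Data.Vec.Properties using (lookup-replicate; lookup∘update; lookup∘update′)
open import Data.Product using (_×_; Σ; _,_; proj₁; proj₂)
open import Data.Sum using (_⊎_; inj₁; inj₂)
open import Data.Empty using (⊥-elim)
open import Relation.Nullary using (yes; no)
open import Relation.Binary.PropositionalEquality
  using (_≡_; _≢_; refl; sym; trans; cong; cong₂; subst; subst₂)
open import Function.Bundles using (_⇔_; mk⇔)
open import Algebra.Properties.CommutativeSemigroup +-commutativeSemigroup
  using (x∙yz≈y∙xz)

letter≤2 : (x : Letter) → toℕ x ≤ 2
letter≤2 F.zero                 = z≤n
letter≤2 (F.suc F.zero)         = s≤s z≤n
letter≤2 (F.suc (F.suc F.zero)) = s≤s (s≤s z≤n)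

below𝟎 : {x y : Letter} → toℕ x ≤ toℕ y → y ≡ 𝟎 → x ≡ 𝟎
below𝟎 {F.zero} _ _ = refl
below𝟎 {F.suc _} {F.zero} () refl

next : Letter → Letter
next F.zero    = 𝟏
next (F.suc _) = 𝟐

next-raises : {x z : Letter} → toℕ x < toℕ z →
  (toℕ (next x) ≡ suc (toℕ x)) × (toℕ (next x) ≤ toℕ z)
next-raises {F.zero}                 lt = refl , lt
next-raises {F.suc F.zero}           lt = refl , lt
next-raises {F.suc (F.suc F.zero)} {z} lt = ⊥-elim (<-irrefl refl (<-≤-trans lt (letter≤2 z)))

next≢𝟎 : (x : Letter) → next x ≢ 𝟎
next≢𝟎 F.zero    ()
next≢𝟎 (F.suc _) ()

weight : ∀ {n} → Word n → ℕ
weight []       = 0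
weight (x ∷ xs) = toℕ x + weight xs

≼-refl : ∀ {n} {a : Word n} → a ≼ a
≼-refl i = ≤-refl

≼-trans : ∀ {n} {a b c : Word n} → a ≼ b → b ≼ c → a ≼ c
≼-trans p q i = ≤-trans (p i) (q i)

≼-tail : ∀ {n} {x y} {xs ys : Word n} → (x ∷ xs) ≼ (y ∷ ys) → xs ≼ ys
≼-tail p i = p (F.suc i)

weight-mono : ∀ {n} {a b : Word n} → a ≼ b → weight a ≤ weight b
weight-mono {a = []}     {[]}     p = z≤n
weight-mono {a = x ∷ xs} {y ∷ ys} p = +-mono-≤ (p F.zero) (weight-mono {a = xs} {ys} (≼-tail p))

weight-injective : ∀ {n} {a b : Word n} → a ≼ b → weight a ≡ weight b → a ≡ b
weight-injective {a = []}     {[]}     p e = refl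
weight-injective {a = x ∷ xs} {y ∷ ys} p e =
  cong₂ _∷_ (FP.toℕ-injective x≡y) (weight-injective (≼-tail p) tails≡)
  where
  x≡y : toℕ x ≡ toℕ y
  x≡y = ≤-antisym (p F.zero) (+-cancelʳ-≤ (weight ys) (toℕ y) (toℕ x)
          (subst (_≤ toℕ x + weight ys) e (+-monoʳ-≤ (toℕ x) (weight-mono {a = xs} {ys} (≼-tail p)))))
  tails≡ : weight xs ≡ weight ys
  tails≡ = +-cancelˡ-≡ (toℕ x) (weight xs) (weight ys) (trans e (cong (_+ weight ys) (sym x≡y)))

weight-strict : ∀ {n} {a b : Word n} → a ≼ b → a ≢ b → weight a < weight b
weight-strict {a = a} {b} p a≢b = ≤∧≢⇒< (weight-mono {a = a} {b} p) (λ e → a≢b (weight-injective p e))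

letter-gain≤weight-gain : ∀ {n} {a b : Word n} → a ≼ b → (j : Fin n) →
  toℕ (lookup b j) + weight a ≤ toℕ (lookup a j) + weight b
letter-gain≤weight-gain {a = x ∷ xs} {y ∷ ys} p F.zero =
  subst (_≤ toℕ x + (toℕ y + weight ys)) (x∙yz≈y∙xz (toℕ x) (toℕ y) (weight xs))
    (+-monoʳ-≤ (toℕ x) (+-monoʳ-≤ (toℕ y) (weight-mono {a = xs} {ys} (≼-tail p))))
letter-gain≤weight-gain {a = x ∷ xs} {y ∷ ys} p (F.suc j) =
  subst₂ _≤_ (x∙yz≈y∙xz (toℕ x) (toℕ (lookup ys j)) (weight xs))
             (x∙yz≈y∙xz (toℕ y) (toℕ (lookup xs j)) (weight ys))
    (+-mono-≤ (p F.zero) (letter-gain≤weight-gain {a = xs} {ys} (≼-tail p) j))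

weight-raise : ∀ {n} (a : Word n) (c : Fin n) (y : Letter) →
  toℕ y ≡ suc (toℕ (lookup a c)) → weight (a [ c ]≔ y) ≡ suc (weight a)
weight-raise (x ∷ xs) F.zero    y e = cong (_+ weight xs) e
weight-raise (x ∷ xs) (F.suc c) y e =
  trans (cong (toℕ x +_) (weight-raise xs c y e)) (+-suc (toℕ x) (weight xs))

unit-step-covers : ∀ {n} {u v : Word n} → IsTr u → IsTr v → u ≼ v →
  weight v ≡ suc (weight u) → u ⋖ v
unit-step-covers {u = u} {v} tu tv u≼v e = tu , tv , u≼v , u≢v , nothing-between
  where
  u≢v : u ≢ v
  u≢v refl = <-irrefl e (n<1+n (weight u))
  nothing-between : (w : Word _) → IsTr w → u ≼ w → w ≼ v → (w ≡ u) ⊎ (w ≡ v)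
  nothing-between w _ u≼w w≼v with weight w ≟ weight u
  ... | yes eq = inj₁ (sym (weight-injective u≼w (sym eq)))
  ... | no neq = inj₂ (weight-injective w≼v (≤-antisym (weight-mono {a = w} {v} w≼v)
                   (subst (_≤ weight w) (sym e)
                     (≤∧≢⇒< (weight-mono {a = u} {w} u≼w) (λ q → neq (sym q))))))

chain-weight-bound : ∀ {n} {a b : Word n} {k} → SatChain a b k → weight a + k ≤ weight b
chain-weight-bound {a = a} (single _) = ≤-reflexive (+-identityʳ (weight a))
chain-weight-bound {a = a} {b} {suc k} (step (_ , _ , a≼v , a≢v , _) c) =
  subst (_≤ weight b) (sym (+-suc (weight a) k))
    (≤-trans (+-monoˡ-≤ k (weight-strict a≼v a≢v)) (chain-weight-bound c))

tight-step : ∀ {n} {a v b : Word n} {k} → a ⋖ v → SatChain v b k →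
  weight a + suc k ≡ weight b → (weight v ≡ suc (weight a)) × (weight v + k ≡ weight b)
tight-step {a = a} {v} {b} {k} (_ , _ , a≼v , a≢v , _) c tight = v-unit , rest-tight
  where
  v-unit : weight v ≡ suc (weight a)
  v-unit = ≤-antisym
    (+-cancelʳ-≤ k (weight v) (suc (weight a))
       (subst (weight v + k ≤_) (trans (sym tight) (+-suc (weight a) k)) (chain-weight-bound c)))
    (weight-strict a≼v a≢v)
  rest-tight : weight v + k ≡ weight b
  rest-tight = trans (cong (_+ k) v-unit) (trans (sym (+-suc (weight a) k)) tight)

chain-start-≼ : ∀ {n} {a b x : Word n} {k} (c : SatChain a b k) → x ∈Ch c → a ≼ x
chain-start-≼ {a = a} (single _) refl = ≼-refl {a = a}
chain-start-≼ {a = a} (step _ c) (inj₁ refl) = ≼-refl {a = a}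
chain-start-≼ {a = a} {x = x} (step {v = v} (_ , _ , a≼v , _) c) (inj₂ x∈c) =
  ≼-trans {a = a} {v} {x} a≼v (chain-start-≼ c x∈c)

start-∈Ch : ∀ {n} {a b : Word n} {k} (c : SatChain a b k) → a ∈Ch c
start-∈Ch (single _) = refl
start-∈Ch (step _ _) = inj₁ refl

_++Ch_ : ∀ {n} {a b d : Word n} {k l} → SatChain a b k → SatChain b d l → SatChain a d (k + l)
single _ ++Ch c₂ = c₂
step p c₁ ++Ch c₂ = step p (c₁ ++Ch c₂)

++Ch-∈ʳ : ∀ {n} {a b d x : Word n} {k l} (c₁ : SatChain a b k) (c₂ : SatChain b d l) →
  x ∈Ch c₂ → x ∈Ch (c₁ ++Ch c₂)
++Ch-∈ʳ (single _) c₂ x∈ = x∈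
++Ch-∈ʳ (step _ c₁) c₂ x∈ = inj₂ (++Ch-∈ʳ c₁ c₂ x∈)

ZeroSuffixed : ∀ {n} → Word n → Set
ZeroSuffixed {n} u = (i : Fin n) → lookup u i ≡ 𝟎 → (j : Fin n) → i ≤ᶠ j → lookup u j ≡ 𝟎

first-difference : ∀ {n} {a b : Word n} → a ≼ b → a ≢ b →
  Σ (Fin n) λ c → (toℕ (lookup a c) < toℕ (lookup b c)) ×
    ((p : Fin n) → p <ᶠ c → lookup a p ≡ lookup b p)
first-difference {a = []} {[]} p a≢b = ⊥-elim (a≢b refl)
first-difference {a = x ∷ xs} {y ∷ ys} p a≢b with x FP.≟ y
... | no x≢y = F.zero , FP.≤∧≢⇒< (p F.zero) x≢y , λ _ ()
... | yes refl with first-difference (≼-tail p) (λ e → a≢b (cong (x ∷_) e))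
...   | c , lt , agree = F.suc c , lt , agree′
  where
  agree′ : (q : Fin _) → q <ᶠ F.suc c → lookup (x ∷ xs) q ≡ lookup (x ∷ ys) q
  agree′ F.zero    _       = refl
  agree′ (F.suc q) (s≤s q<c) = agree q q<c

first-letter-below-Tr : ∀ {n} {w b : Word n} → w ≼ b → IsTr b →
  (i : Fin n) → toℕ i ≡ 0 → lookup w i ≢ 𝟐
first-letter-below-Tr {w = w} {b} w≼b tb i i≡0 w≡2 = proj₁ tb i i≡0 (is𝟐 (lookup b i) 2≤b)
  where
  2≤b : 2 ≤ toℕ (lookup b i)
  2≤b = subst (λ z → toℕ z ≤ toℕ (lookup b i)) w≡2 (w≼b i)
  is𝟐 : (z : Letter) → 2 ≤ toℕ z → z ≡ 𝟐
  is𝟐 (F.suc F.zero)         (s≤s ())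
  is𝟐 (F.suc (F.suc F.zero)) _ = refl

update-between : ∀ {n} {a b : Word n} (c : Fin n) (y : Letter) → a ≼ b →
  toℕ (lookup a c) ≤ toℕ y → toℕ y ≤ toℕ (lookup b c) → a ≼ (a [ c ]≔ y) × (a [ c ]≔ y) ≼ b
update-between {a = a} {b} c y a≼b a≤y y≤b = lower , upper
  where
  lower : a ≼ (a [ c ]≔ y)
  lower q with q FP.≟ c
  ... | yes refl = subst (λ z → toℕ (lookup a q) ≤ toℕ z) (sym (lookup∘update q a y)) a≤y
  ... | no q≢c = ≤-reflexive (cong toℕ (sym (lookup∘update′ q≢c a y)))
  upper : (a [ c ]≔ y) ≼ b
  upper q with q FP.≟ c
  ... | yes refl = subst (λ z → toℕ z ≤ toℕ (lookup b q)) (sym (lookup∘update q a y)) y≤b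
  ... | no q≢c = subst (λ z → toℕ z ≤ toℕ (lookup b q)) (sym (lookup∘update′ q≢c a y)) (a≼b q)

-- A new pattern 01 could only have its 0 before c, where a agrees
-- with b; but then b, being zero-suffixed, would vanish at c, below which a_c lies.
update-first-difference-Tr : ∀ {n} {a b : Word n} (c : Fin n) (y : Letter) →
  IsTr a → IsTr b → ZeroSuffixed b → (a [ c ]≔ y) ≼ b → y ≢ 𝟎 →
  toℕ (lookup a c) < toℕ (lookup b c) → ((p : Fin n) → p <ᶠ c → lookup a p ≡ lookup b p) →
  IsTr (a [ c ]≔ y)
update-first-difference-Tr {n} {a} {b} c y ta tb zs-b a′≼b y≢0 a<b-at-c agree =
  first-letter-below-Tr {w = a [ c ]≔ y} {b} a′≼b tb , no-01
  where
  no-01 : (i j : Fin n) → i <ᶠ j → lookup (a [ c ]≔ y) i ≡ 𝟎 → lookup (a [ c ]≔ y) j ≢ 𝟏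
  no-01 i j i<j a′-at-i≡0 a′-at-j≡1 with j FP.≟ c | i FP.≟ c
  ... | yes refl | yes refl = <-irrefl refl i<j
  ... | yes refl | no i≢c = n≮0 (subst (λ z → toℕ (lookup a j) < toℕ z) b-at-j≡0 a<b-at-c)
    where
    b-at-i≡0 : lookup b i ≡ 𝟎
    b-at-i≡0 = trans (sym (agree i i<j)) (trans (sym (lookup∘update′ i≢c a y)) a′-at-i≡0)
    b-at-j≡0 : lookup b j ≡ 𝟎
    b-at-j≡0 = zs-b i b-at-i≡0 j (<⇒≤ i<j)
  ... | no j≢c | yes refl = y≢0 (trans (sym (lookup∘update i a y)) a′-at-i≡0)
  ... | no j≢c | no i≢c = proj₂ ta i j i<j (trans (sym (lookup∘update′ i≢c a y)) a′-at-i≡0)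
                                            (trans (sym (lookup∘update′ j≢c a y)) a′-at-j≡1)

greedy-step : ∀ {n} {a b : Word n} → IsTr a → IsTr b → ZeroSuffixed b → a ≼ b → a ≢ b →
  Σ (Word n) λ a′ → IsTr a′ × a ≼ a′ × a′ ≼ b × weight a′ ≡ suc (weight a)
greedy-step {a = a} {b} ta tb zs-b a≼b a≢b with first-difference a≼b a≢b
... | c , a<b-at-c , agree = a′ , ta′ , proj₁ between , proj₂ between , weight-raise a c y y-succ
  where
  y : Letter
  y = next (lookup a c)
  y-succ : toℕ y ≡ suc (toℕ (lookup a c))
  y-succ = proj₁ (next-raises a<b-at-c)
  a′ : Word _
  a′ = a [ c ]≔ y
  between : a ≼ a′ × a′ ≼ b
  between = update-between {a = a} {b} c y a≼b (≤-trans (n≤1+n _) (≤-reflexive (sym y-succ)))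
                                   (proj₂ (next-raises a<b-at-c))
  ta′ : IsTr a′
  ta′ = update-first-difference-Tr {a = a} {b} c y ta tb zs-b (proj₂ between) (next≢𝟎 (lookup a c))
                                   a<b-at-c agree

greedy-chain : ∀ {n} (d : ℕ) {a b : Word n} → IsTr a → IsTr b → ZeroSuffixed b → a ≼ b →
  weight a + d ≡ weight b → SatChain a b d
greedy-chain zero {a} ta tb zs-b a≼b e =
  subst (λ z → SatChain a z 0) (weight-injective a≼b (trans (sym (+-identityʳ (weight a))) e)) (single ta)
greedy-chain (suc d) {a} {b} ta tb zs-b a≼b e
  with greedy-step ta tb zs-b a≼b a≢b
  where
  a≢b : a ≢ b
  a≢b refl = <-irrefl (sym e) (m<m+n (weight a) (s≤s z≤n))
... | a′ , ta′ , a≼a′ , a′≼b , a′-unit =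
  step (unit-step-covers {u = a} {a′} ta ta′ a≼a′ a′-unit)
       (greedy-chain d {a′} ta′ tb zs-b a′≼b
          (trans (cong (_+ d) a′-unit) (trans (sym (+-suc (weight a) d)) e)))

unit-step-keeps-2 : ∀ {n} {a v : Word n} → IsTr a → a ≼ v → weight v ≡ suc (weight a) →
  (i j : Fin n) → i <ᶠ j → lookup a i ≡ 𝟎 → lookup v j ≡ 𝟐 → lookup a j ≡ 𝟐
unit-step-keeps-2 {a = a} {v} ta a≼v v-unit i j i<j a-at-i≡0 v-at-j≡2 = cases (lookup a j) refl 1≤a-at-j
  where
  1≤a-at-j : 1 ≤ toℕ (lookup a j)
  1≤a-at-j = +-cancelʳ-≤ (suc (weight a)) 1 (toℕ (lookup a j))
    (subst₂ (λ y z → toℕ y + weight a ≤ toℕ (lookup a j) + z) v-at-j≡2 v-unit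
      (letter-gain≤weight-gain {a = a} {v} a≼v j))
  cases : (y : Letter) → lookup a j ≡ y → 1 ≤ toℕ y → y ≡ 𝟐
  cases (F.suc F.zero)         a-at-j≡1 _ = ⊥-elim (proj₂ ta i j i<j a-at-i≡0 a-at-j≡1)
  cases (F.suc (F.suc F.zero)) _        _ = refl

tight-chain-keeps-2 : ∀ {n} {a b x : Word n} {k} (c : SatChain a b k) → weight a + k ≡ weight b →
  x ∈Ch c → (i j : Fin n) → i <ᶠ j → lookup x i ≡ 𝟎 → lookup x j ≡ 𝟐 → lookup a j ≡ 𝟐
tight-chain-keeps-2 (single _) _ refl i j i<j x-at-i x-at-j = x-at-j
tight-chain-keeps-2 (step _ _) _ (inj₁ refl) i j i<j x-at-i x-at-j = x-at-j
tight-chain-keeps-2 {a = a} {b} c@(step {v = v} {k = k} a⋖v@(ta , _ , a≼v , _) rest) tight x∈@(inj₂ x∈rest)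
                    i j i<j x-at-i x-at-j =
  unit-step-keeps-2 {a = a} {v} ta a≼v (proj₁ split) i j i<j
    (below𝟎 (chain-start-≼ c x∈ i) x-at-i)
    (tight-chain-keeps-2 rest (proj₂ split) x∈rest i j i<j x-at-i x-at-j)
  where
  split : (weight v ≡ suc (weight a)) × (weight v + k ≡ weight b)
  split = tight-step a⋖v rest tight

weight-bot : ∀ n → weight (bot n) ≡ 0
weight-bot zero    = refl
weight-bot (suc n) = weight-bot n

weight-twos : ∀ m → weight (replicate m 𝟐) ≡ m + m
weight-twos zero    = refl
weight-twos (suc m) = cong suc (trans (cong suc (weight-twos m)) (sym (+-suc m m)))

weight-top : ∀ m → weight (top m) ≡ 2 * suc m ∸ 1
weight-top m = trans (cong suc (weight-twos m))
  (trans (cong (λ z → suc (m + z)) (sym (+-identityʳ m))) (sym (+-suc m (m + 0))))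

bot-Tr : ∀ n → IsTr (bot n)
bot-Tr n = (λ i _ e → 0≢2 (trans (sym (lookup-replicate i 𝟎)) e))
         , (λ i j _ _ e → 0≢1 (trans (sym (lookup-replicate j 𝟎)) e))
  where
  0≢2 : 𝟎 ≢ 𝟐
  0≢2 ()
  0≢1 : 𝟎 ≢ 𝟏
  0≢1 ()

top-Tr : ∀ m → IsTr (top m)
top-Tr m = first≢2 , no-0
  where
  first≢2 : (i : Fin (suc m)) → toℕ i ≡ 0 → lookup (top m) i ≢ 𝟐
  first≢2 F.zero _ ()
  no-0 : (i j : Fin (suc m)) → i <ᶠ j → lookup (top m) i ≡ 𝟎 → lookup (top m) j ≢ 𝟏
  no-0 (F.suc i) j _ e with trans (sym (lookup-replicate i 𝟐)) e
  ... | ()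

top-ZeroSuffixed : ∀ m → ZeroSuffixed (top m)
top-ZeroSuffixed m (F.suc i) e with trans (sym (lookup-replicate i 𝟐)) e
... | ()

bot-≼ : ∀ {n} (u : Word n) → bot n ≼ u
bot-≼ u i = subst (λ z → toℕ z ≤ toℕ (lookup u i)) (sym (lookup-replicate i 𝟎)) z≤n

≼-top : ∀ m (u : Word (suc m)) → IsTr u → u ≼ top m
≼-top m u tu F.zero = first≤1 (lookup u F.zero) (proj₁ tu F.zero refl)
  where
  first≤1 : (x : Letter) → x ≢ 𝟐 → toℕ x ≤ 1
  first≤1 F.zero                 _   = z≤n
  first≤1 (F.suc F.zero)         _   = s≤s z≤n
  first≤1 (F.suc (F.suc F.zero)) x≢2 = ⊥-elim (x≢2 refl)
≼-top m u tu (F.suc i) =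
  subst (λ z → toℕ (lookup u (F.suc i)) ≤ toℕ z) (sym (lookup-replicate i 𝟐)) (letter≤2 _)

bot-top-bound : ∀ {m k} → SatChain (bot (suc m)) (top m) k → k ≤ weight (top m)
bot-top-bound {m} c = subst (_≤ weight (top m)) (cong (_+ _) (weight-bot (suc m))) (chain-weight-bound c)

chain-through : ∀ m (u : Word (suc m)) → IsTr u → ZeroSuffixed u →
  Σ ℕ λ k → Σ (SatChain (bot (suc m)) (top m) k) λ c → (k ≡ weight (top m)) × u ∈Ch c
chain-through m u tu zs-u =
  _ , below ++Ch above , length-eq , ++Ch-∈ʳ below above (start-∈Ch above)
  where
  length-eq : weight u + (weight (top m) ∸ weight u) ≡ weight (top m)
  length-eq = m+[n∸m]≡n (weight-mono {a = u} {top m} (≼-top m u tu))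
  below : SatChain (bot (suc m)) u (weight u)
  below = greedy-chain (weight u) (bot-Tr _) tu zs-u (bot-≼ u) (cong (_+ weight u) (weight-bot (suc m)))
  above : SatChain u (top m) (weight (top m) ∸ weight u)
  above = greedy-chain _ tu (top-Tr m) (top-ZeroSuffixed m) (≼-top m u tu) length-eq

attains-bound⇒longest : ∀ {m k} (c : SatChain (bot (suc m)) (top m) k) →
  k ≡ weight (top m) → IsLongest c
attains-bound⇒longest _ refl c′ = bot-top-bound c′

longest-through : ∀ m (u : Word (suc m)) → IsTr u → ZeroSuffixed u →
  Σ ℕ λ k → Σ (SatChain (bot (suc m)) (top m) k) λ c → IsLongest c × u ∈Ch c
longest-through m u tu zs-u with chain-through m u tu zs-u
... | k , c , k≡ , u∈c = k , c , attains-bound⇒longest c k≡ , u∈c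

longest-length : ∀ {m k} (c : SatChain (bot (suc m)) (top m) k) → IsLongest c → k ≡ weight (top m)
longest-length {m} c longest with chain-through m (top m) (top-Tr m) (top-ZeroSuffixed m)
... | _ , c-max , refl , _ = ≤-antisym (bot-top-bound c) (longest c-max)

-- A triword on a longest chain is zero-suffixed: after a 0 there is no 1 since
-- it is a triword, and no 2 since the chain is tight and starts at 0^n.
on-longest⇒ZeroSuffixed : ∀ {m k} {u : Word (suc m)} → IsTr u →
  (c : SatChain (bot (suc m)) (top m) k) → IsLongest c → u ∈Ch c → ZeroSuffixed u
on-longest⇒ZeroSuffixed {m} {k} {u} tu c longest u∈c i u-at-i j i≤j with i FP.≟ j
... | yes refl = u-at-i
... | no i≢j = letter-after-0 (lookup u j) refl
  where
  i<j : i <ᶠ j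
  i<j = FP.≤∧≢⇒< i≤j i≢j
  tight : weight (bot (suc m)) + k ≡ weight (top m)
  tight = trans (cong (_+ k) (weight-bot (suc m))) (longest-length c longest)
  letter-after-0 : (y : Letter) → lookup u j ≡ y → lookup u j ≡ 𝟎
  letter-after-0 F.zero                 u-at-j = u-at-j
  letter-after-0 (F.suc F.zero)         u-at-j = ⊥-elim (proj₂ tu i j i<j u-at-i u-at-j)
  letter-after-0 (F.suc (F.suc F.zero)) u-at-j
    with trans (sym (lookup-replicate j 𝟎)) (tight-chain-keeps-2 c tight u∈c i j i<j u-at-i u-at-j)
  ... | ()

lemma3p1 : (m : ℕ) →
    ( (Σ ℕ λ k → Σ (SatChain (bot (suc m)) (top m) k) λ c → IsLongest c)
    × (∀ {k} (c : SatChain (bot (suc m)) (top m) k) → IsLongest c → k ≡ 2 * suc m ∸ 1) )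
    × ((u : Word (suc m)) → IsTr u →
        ((Σ ℕ λ k → Σ (SatChain (bot (suc m)) (top m) k) λ c → IsLongest c × u ∈Ch c)
         ⇔ ((i : Fin (suc m)) → lookup u i ≡ 𝟎 → (j : Fin (suc m)) → i ≤ᶠ j → lookup u j ≡ 𝟎)))
lemma3p1 m with longest-through m (top m) (top-Tr m) (top-ZeroSuffixed m)
... | k-max , c-max , longest-max , _ =
  ( (k-max , c-max , longest-max)
  , λ c longest → trans (longest-length c longest) (weight-top m) )
  , λ u tu → mk⇔ (λ (_ , c , longest , u∈c) → on-longest⇒ZeroSuffixed tu c longest u∈c)
                 (longest-through m u tu)
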